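{- Let $R_{(\mathbb{G},\mathcal{S})}(\mathbb{X},\mathcal{C})$ be a Ramsey number with a base and symbol of locally finite type. Let $f_i:A_i\to\mathbb{F}_{q_i}$ be injections ($q_i\ge|A_i|$ prime powers), $S_i'=\{f_i\circ\rho:\rho\in S_i\}$ and $C_i'=\{f_i\circ\psi_j\}_{j\in J_i}$. Then $R_{(\mathbb{G},\mathcal{S})}(\mathbb{X},\mathcal{C})=n$ if and only if $n$ is the least value in $I$ such that for all $t\ge n$, $$S_t'\subseteq V\big(\langle p[G_t,\mathbb{X}_t,C_t']\rangle\big),$$ or, equivalently, $I(S_t')\supseteq\langle p[G_t,\mathbb{X}_t,C_t']\rangle$ for all $t\ge n$.
   Context: All graphs are finite and undirected; $\mathrm{Hom}(G,A)$ is the set of maps $E(G)\to A$. The isomorphism set $G/X$ is the set of edge maps $\pi:E(Y)\to E(X)$ induced by graph isomorphisms $V(Y)\to V(X)$, $Y$ ranging over subgraphs of $G$; $\pi^{ -1}(X)$ denotes $E(Y)$. $I$ is strictly well-ordered with least element $0$; $\mathbb{G}=\{G_i\}_{i\in I}$ is hereditary: for $0<i\le k$, each $G_s$ with $s<i$ satisfies $G_t/G_s\ne\emptyset$ for all $t\ge k$. Ramsey base $(\mathbb{G},\mathcal{S})$: $\mathcal{S}=\{S_i\}$, $S_i\subseteq\mathrm{Hom}(G_i,A_i)$. Ramsey symbol $(\mathbb{X},\mathcal{C})$: $\mathbb{X}=\{\mathbb{X}_i\}$, $\mathbb{X}_i=\{X_j\}_{j\in J_i}$ ($J_i$ finite),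 $C_i=\{\psi_j\}_{j\in J_i}$, $\psi_j\in\mathrm{Hom}(X_j,A_i)$, with $\{\coprod_{j\in J_i}X_j\}_i$ hereditary. Locally finite type: $|A_i|<\infty$ for all $i$. $R_{(\mathbb{G},\mathcal{S})}(\mathbb{X},\mathcal{C})$ is the least $n\in I$ (if any) such that for all $t\ge n$ and all $\rho\in S_t$ there exist $j\in J_t$, $\pi\in G_t/X_j$ with $\rho(e)=\psi_j(\pi(e))$ for all $e\in\pi^{ -1}(X_j)$. Colorings are identified with points of $\mathbb{F}_q^{(E(G))}$. For $\phi\in\mathrm{Hom}(X,\mathbb{F}_q)$, $p[G,X,\phi](x)=\prod_{\pi\in G/X}\big(1-\prod_{e\in\pi^{ -1}(X)}(1-(x_e-\phi(\pi(e)))^{q-1})\big)$, and $p[G,\{X_j\},\{\phi_j\}]=\prod_j p[G,X_j,\phi_j]$. $V(\mathcal{J})$ is the common zero set in $\mathbb{F}_{q_t}^{(E(G_t))}$ of an ideal $\mathcal{J}$; $I(U)$ is the ideal of polynomials vanishing on a point set $U$. -}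

module Defs where

open import Level using (0ℓ)
open import Data.Nat as ℕ using (ℕ; zero; suc)
open import Data.Nat.Primality using (Prime)
open import Data.Fin as Fin using (Fin; toℕ; splitAt; _↑ˡ_; _↑ʳ_)
open import Data.Bool using (Bool; true; false; T; _∧_; if_then_else_)
open import Data.Product using (Σ; ∃; ∃-syntax; _×_; _,_; proj₁; proj₂)
open import Data.Sum using (_⊎_; inj₁; inj₂)
open import Data.Maybe using (Maybe; just; nothing)
open import Data.List as List using (List; []; _∷_; map; foldr; allFin; concatMap; mapMaybe; deduplicateᵇ)
open import Data.List.Membership.Propositional using (_∈_)
open import Data.Vec as Vec using (Vec)
open import Relation.Nullary using (¬_; yes; no)
open import Relation.Nullary.Decidable using (T?)
open import Relation.Binary.PropositionalEquality using (_≡_)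
open import Relation.Binary.Core using (Rel)
open import Relation.Binary.Structures using (IsStrictTotalOrder)
open import Induction.WellFounded using (WellFounded)
open import Algebra.Structures using (IsCommutativeRing)
open import Function.Bundles using (_↔_)
open import Function.Definitions using (Injective)

-- The edge set is {(i , j) | i < j and adj i j};
-- only the strict upper triangle of adj is consulted, so the graph is
-- undirected and loopless by construction.

record Graph : Set where
  field
    nv  : ℕ
    adj : Fin nv → Fin nv → Bool
open Graph public

isEdgeᵇ : (G : Graph) → Fin (nv G) × Fin (nv G) → Bool
isEdgeᵇ G (i , j) = (toℕ i ℕ.<ᵇ toℕ j) ∧ adj G i j

Edge : Graph → Set
Edge G = Σ (Fin (nv G) × Fin (nv G)) (λ p → T (isEdgeᵇ G p))

Hom : Graph → Set → Set
Hom G A = Edge G → A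

allPairs : (n : ℕ) → List (Fin n × Fin n)
allPairs n = List.cartesianProduct (allFin n) (allFin n)

mkEdge : (G : Graph) → Fin (nv G) × Fin (nv G) → Maybe (Edge G)
mkEdge G p with T? (isEdgeᵇ G p)
... | yes t = just (p , t)
... | no _  = nothing

allEdges : (G : Graph) → List (Edge G)
allEdges G = mapMaybe (mkEdge G) (allPairs (nv G))

edgeBetween : (G : Graph) → Fin (nv G) → Fin (nv G) → Maybe (Edge G)
edgeBetween G u v = if toℕ u ℕ.<ᵇ toℕ v then mkEdge G (u , v) else mkEdge G (v , u)

_⊕_ : Graph → Graph → Graph
G ⊕ H = record { nv = nv G ℕ.+ nv H ; adj = a }
  where
  a : Fin (nv G ℕ.+ nv H) → Fin (nv G ℕ.+ nv H) → Bool
  a i j with splitAt (nv G) i | splitAt (nv G) j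
  ... | inj₁ i' | inj₁ j' = adj G i' j'
  ... | inj₂ i' | inj₂ j' = adj H i' j'
  ... | _       | _       = false

emptyGraph : Graph
emptyGraph = record { nv = 0 ; adj = λ () }

Coprod : (m : ℕ) → (Fin m → Graph) → Graph
Coprod zero    X = emptyGraph
Coprod (suc m) X = X Fin.zero ⊕ Coprod m (λ j → X (Fin.suc j))

-- An element π : E(Y) → E(X) (Y a subgraph of G isomorphic to X via a
-- vertex bijection V(Y) → V(X)) is represented by its graph: the list of
-- pairs (e , π e) for e ∈ π⁻¹(X) = E(Y).  Such a vertex isomorphism is the
-- inverse of an injective map ι : V(X) → V(G) sending edges of X to edges
-- of G (Y := image of ι with the image edges).  Distinct ι may induce the
-- same edge map, so the list is deduplicated (G/X is a *set* of edge maps).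

EdgeMap : Graph → Graph → Set
EdgeMap G X = List (Edge G × Edge X)

allVecs : (n k : ℕ) → List (Vec (Fin n) k)
allVecs n zero    = Vec.[] ∷ []
allVecs n (suc k) = concatMap (λ v → map (λ a → a Vec.∷ v) (allFin n)) (allVecs n k)

injectiveᵇ : ∀ {n k} → Vec (Fin n) k → Bool
injectiveᵇ {n} {k} v =
  and (map (λ { (a , b) → if toℕ a ℕ.≡ᵇ toℕ b then true
                               else Data.Bool.not (toℕ (Vec.lookup v a) ℕ.≡ᵇ toℕ (Vec.lookup v b)) })
                (allPairs k))
  where import Data.Bool
        open import Data.Bool.ListAction using (and)

inducedMap : (G X : Graph) → Vec (Fin (nv G)) (nv X) → Maybe (EdgeMap G X)
inducedMap G X ι = if injectiveᵇ ι then go (allEdges X) else nothing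
  where
  go : List (Edge X) → Maybe (EdgeMap G X)
  go [] = just []
  go (d ∷ ds) with edgeBetween G (Vec.lookup ι (proj₁ (proj₁ d))) (Vec.lookup ι (proj₂ (proj₁ d))) | go ds
  ... | just e | just rest = just ((e , d) ∷ rest)
  ... | _      | _         = nothing

finPairEqᵇ : ∀ {n} → Fin n × Fin n → Fin n × Fin n → Bool
finPairEqᵇ (a , b) (c , d) = (toℕ a ℕ.≡ᵇ toℕ c) ∧ (toℕ b ℕ.≡ᵇ toℕ d)

edgeMapEqᵇ : ∀ {G X} → EdgeMap G X → EdgeMap G X → Bool
edgeMapEqᵇ [] [] = true
edgeMapEqᵇ ((e , d) ∷ xs) ((e' , d') ∷ ys) =
  finPairEqᵇ (proj₁ e) (proj₁ e') ∧ finPairEqᵇ (proj₁ d) (proj₁ d') ∧ edgeMapEqᵇ xs ys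
edgeMapEqᵇ _ _ = false

IsoSet : (G X : Graph) → List (EdgeMap G X)
IsoSet G X = deduplicateᵇ edgeMapEqᵇ (mapMaybe (inducedMap G X) (allVecs (nv G) (nv X)))

record WellOrderedIndex : Set₁ where
  field
    Idx        : Set
    _<_        : Rel Idx 0ℓ
    isSTO      : IsStrictTotalOrder _≡_ _<_
    wf         : WellFounded _<_
    𝟎          : Idx
    𝟎-least    : ∀ i → ¬ (i < 𝟎)

  _≤_ : Rel Idx 0ℓ
  i ≤ j = i ≡ j ⊎ i < j

Hereditary : (𝕀 : WellOrderedIndex) → (WellOrderedIndex.Idx 𝕀 → Graph) → Set
Hereditary 𝕀 G =
  ∀ i k → 𝟎 < i → i ≤ k → ∀ s → s < i → ∀ t → k ≤ t → ¬ (IsoSet (G t) (G s) ≡ [])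
  where open WellOrderedIndex 𝕀

IsLeast : (𝕀 : WellOrderedIndex) → (WellOrderedIndex.Idx 𝕀 → Set) → WellOrderedIndex.Idx 𝕀 → Set
IsLeast 𝕀 P n = P n × (∀ m → P m → n ≤ m)
  where open WellOrderedIndex 𝕀

record RamseyBase (𝕀 : WellOrderedIndex) : Set₁ where
  open WellOrderedIndex 𝕀
  field
    G        : Idx → Graph
    A        : Idx → Set
    S        : (i : Idx) → Hom (G i) (A i) → Set
    G-hered  : Hereditary 𝕀 G

record RamseySymbol (𝕀 : WellOrderedIndex) (A : WellOrderedIndex.Idx 𝕀 → Set) : Set₁ where
  open WellOrderedIndex 𝕀
  field
    m        : Idx → ℕ                                  -- J_i = Fin (m i)
    X        : (i : Idx) → Fin (m i) → Graph
    ψ        : (i : Idx) → (j : Fin (m i)) → Hom (X i j) (A i)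
    X-hered  : Hereditary 𝕀 (λ i → Coprod (m i) (X i))

Finite : Set → Set
Finite A = ∃[ k ] (Fin k ↔ A)

LocallyFinite : (𝕀 : WellOrderedIndex) → RamseyBase 𝕀 → Set
LocallyFinite 𝕀 B = ∀ i → Finite (RamseyBase.A B i)

RamseyCondition : (𝕀 : WellOrderedIndex) (B : RamseyBase 𝕀) →
                  RamseySymbol 𝕀 (RamseyBase.A B) → WellOrderedIndex.Idx 𝕀 → Set
RamseyCondition 𝕀 B Σ' n =
  ∀ t → n ≤ t → ∀ (ρ : Hom (G t) (A t)) → S t ρ →
    ∃[ j ] ∃[ π ] (π ∈ IsoSet (G t) (X t j)) ×
      (∀ e d → (e , d) ∈ π → ρ e ≡ ψ t j d)
  where open WellOrderedIndex 𝕀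
        open RamseyBase B
        open RamseySymbol Σ'

RamseyNumberIs : (𝕀 : WellOrderedIndex) (B : RamseyBase 𝕀) →
                 RamseySymbol 𝕀 (RamseyBase.A B) → WellOrderedIndex.Idx 𝕀 → Set
RamseyNumberIs 𝕀 B Σ' = IsLeast 𝕀 (RamseyCondition 𝕀 B Σ')

record FiniteField : Set₁ where
  field
    F       : Set
    _+_ _*_ : F → F → F
    -_      : F → F
    0# 1#   : F
    isCommutativeRing : IsCommutativeRing _≡_ _+_ _*_ -_ 0# 1#
    0≢1     : ¬ (0# ≡ 1#)
    inverse : ∀ x → ¬ (x ≡ 0#) → ∃[ y ] (x * y ≡ 1#)
    q       : ℕ
    card    : Fin q ↔ F

PrimePower : ℕ → Set
PrimePower q = ∃[ p ] ∃[ k ] Prime p × q ≡ p ℕ.^ suc k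

-- Polynomial ring F[x_v : v ∈ V]: terms modulo the commutative-ring
-- axioms (the free commutative F-algebra on V).

module Polynomials (𝔽 : FiniteField) where
  open FiniteField 𝔽

  infixl 6 _+ₚ_
  infixl 7 _*ₚ_

  data Poly (V : Set) : Set where
    con  : F → Poly V
    var  : V → Poly V
    _+ₚ_ : Poly V → Poly V → Poly V
    _*ₚ_ : Poly V → Poly V → Poly V
    -ₚ_  : Poly V → Poly V

  infix 4 _≈ₚ_
  data _≈ₚ_ {V : Set} : Poly V → Poly V → Set where
    refl  : ∀ {a} → a ≈ₚ a
    sym   : ∀ {a b} → a ≈ₚ b → b ≈ₚ a
    trans : ∀ {a b c} → a ≈ₚ b → b ≈ₚ c → a ≈ₚ c
    +-cong : ∀ {a b c d} → a ≈ₚ b → c ≈ₚ d → a +ₚ c ≈ₚ b +ₚ d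
    *-cong : ∀ {a b c d} → a ≈ₚ b → c ≈ₚ d → a *ₚ c ≈ₚ b *ₚ d
    -‿cong : ∀ {a b} → a ≈ₚ b → -ₚ a ≈ₚ -ₚ b
    +-assoc : ∀ a b c → (a +ₚ b) +ₚ c ≈ₚ a +ₚ (b +ₚ c)
    +-comm  : ∀ a b → a +ₚ b ≈ₚ b +ₚ a
    +-idˡ   : ∀ a → con 0# +ₚ a ≈ₚ a
    -‿invˡ  : ∀ a → (-ₚ a) +ₚ a ≈ₚ con 0#
    *-assoc : ∀ a b c → (a *ₚ b) *ₚ c ≈ₚ a *ₚ (b *ₚ c)
    *-comm  : ∀ a b → a *ₚ b ≈ₚ b *ₚ a
    *-idˡ   : ∀ a → con 1# *ₚ a ≈ₚ a
    distribˡ : ∀ a b c → a *ₚ (b +ₚ c) ≈ₚ (a *ₚ b) +ₚ (a *ₚ c)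
    con-+   : ∀ x y → con x +ₚ con y ≈ₚ con (x + y)
    con-*   : ∀ x y → con x *ₚ con y ≈ₚ con (x * y)
    con--   : ∀ x → -ₚ con x ≈ₚ con (- x)

  _-ₚ_ : ∀ {V} → Poly V → Poly V → Poly V
  a -ₚ b = a +ₚ (-ₚ b)

  _^ₚ_ : ∀ {V} → Poly V → ℕ → Poly V
  a ^ₚ zero  = con 1#
  a ^ₚ suc n = a *ₚ (a ^ₚ n)

  prodₚ : ∀ {V} → List (Poly V) → Poly V
  prodₚ = foldr _*ₚ_ (con 1#)

  eval : ∀ {V} → (V → F) → Poly V → F
  eval x (con c)   = c
  eval x (var v)   = x v
  eval x (a +ₚ b)  = eval x a + eval x b
  eval x (a *ₚ b)  = eval x a * eval x b
  eval x (-ₚ a)    = - eval x a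

  ⟨_⟩ : ∀ {V} → Poly V → Poly V → Set
  ⟨ p ⟩ g = ∃[ h ] (g ≈ₚ h *ₚ p)

  𝕍 : ∀ {V} → (Poly V → Set) → (V → F) → Set
  𝕍 𝒥 x = ∀ g → 𝒥 g → eval x g ≡ 0#

  𝕀 : ∀ {V} → ((V → F) → Set) → Poly V → Set
  𝕀 U g = ∀ x → U x → eval x g ≡ 0#

  pGXφ : (G X : Graph) → Hom X F → Poly (Edge G)
  pGXφ G X φ =
    prodₚ (map (λ π → con 1# -ₚ
                 prodₚ (map (λ { (e , d) → con 1# -ₚ ((var e -ₚ con (φ d)) ^ₚ (q ℕ.∸ 1)) }) π))
               (IsoSet G X))

  pFamily : (G : Graph) (m : ℕ) (X : Fin m → Graph) → ((j : Fin m) → Hom (X j) F) → Poly (Edge G)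
  pFamily G m X φ = prodₚ (List.tabulate (λ j → pGXφ G (X j) (φ j)))

module Transported (𝕀ₒ : WellOrderedIndex) (B : RamseyBase 𝕀ₒ)
                   (Σ' : RamseySymbol 𝕀ₒ (RamseyBase.A B))
                   (𝔽 : WellOrderedIndex.Idx 𝕀ₒ → FiniteField)
                   (f : (i : WellOrderedIndex.Idx 𝕀ₒ) → RamseyBase.A B i → FiniteField.F (𝔽 i)) where
  open WellOrderedIndex 𝕀ₒ
  open RamseyBase B
  open RamseySymbol Σ'

  S′ : (t : Idx) → (Edge (G t) → FiniteField.F (𝔽 t)) → Set
  S′ t x = ∃[ ρ ] S t ρ × (∀ e → x e ≡ f t (ρ e))

  C′ : (t : Idx) → (j : Fin (m t)) → Hom (X t j) (FiniteField.F (𝔽 t))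
  C′ t j d = f t (ψ t j d)

  pₜ : (t : Idx) → Polynomials.Poly (𝔽 t) (Edge (G t))
  pₜ t = Polynomials.pFamily (𝔽 t) (G t) (m t) (X t) (C′ t)

  VanishingCondition : Idx → Set
  VanishingCondition n =
    ∀ t → n ≤ t → ∀ x → S′ t x → Polynomials.𝕍 (𝔽 t) (Polynomials.⟨_⟩ (𝔽 t) (pₜ t)) x

  IdealCondition : Idx → Set
  IdealCondition n =
    ∀ t → n ≤ t → ∀ g → Polynomials.⟨_⟩ (𝔽 t) (pₜ t) g → Polynomials.𝕀 (𝔽 t) (S′ t) g

-- Fermat's little theorem makes 1 − (x_e − φ(d))^(q−1) the indicator of x_e = φ(d) on F_q.
-- Hence the factor 1 − ∏_{e ∈ π⁻¹(X)} (…) of p[G,X,φ] vanishes at a colouring x exactly when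
-- x agrees with φ along the copy π, and since F_q has no zero divisors, p[G_t,𝕏_t,C_t'] vanishes
-- at x iff x contains a copy of some (X_j, f_t ∘ ψ_j).  As f_t is injective, f_t ∘ ρ contains a
-- copy of f_t ∘ ψ_j iff ρ contains a copy of ψ_j.  So for every n the Ramsey condition and the
-- vanishing condition coincide, and therefore have the same least element; the ideal condition
-- is the vanishing condition with its quantifiers reordered.
module Submission where

open import Defs
open import Level using (0ℓ)
open import Data.Nat using (zero; suc; _∸_)
open import Data.Fin as Fin using (Fin; punchIn)
open import Data.Fin.Properties using (punchInᵢ≢i)
open import Data.Fin.Permutation using (Permutation; _⟨$⟩ʳ_; remove; punchIn-permute)
open import Data.Product using (∃-syntax; _×_; _,_; map₂)
open import Data.Sum using (_⊎_; inj₁; inj₂)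
open import Data.Empty using (⊥-elim)
open import Data.List using ([]; _∷_; map)
open import Data.List.Membership.Propositional using (_∈_; find; lose)
open import Data.List.Relation.Unary.Any using (Any; here; there)
import Data.List.Relation.Unary.Any.Properties as Anyₚ
open import Data.List.Relation.Unary.All as All using (All; []; _∷_)
import Data.List.Relation.Unary.All.Properties as Allₚ
open import Function.Base using (_∘_; case_of_)
open import Function.Definitions using (Injective)
open import Function.Bundles using (_⇔_; mk⇔; Equivalence; _↔_; Inverse; Injection; mk↔ₛ′)
open import Function.Properties.Inverse using (↔-sym; ↔-trans; ↔⇒↣)
open import Function.Properties.Equivalence using () renaming (sym to ⇔-sym; trans to ⇔-trans)
open import Relation.Nullary using (yes; no)
open import Relation.Nullary.Decidable using (via-injection)
open import Relation.Binary.Definitions using (DecidableEquality)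
open import Relation.Binary.PropositionalEquality
  using (_≡_; _≢_; refl; sym; trans; cong; cong₂; module ≡-Reasoning)
open import Algebra.Bundles using (CommutativeRing)

module FiniteFieldProperties (𝔽 : FiniteField) where
  open FiniteField 𝔽 public using (F; q; 0≢1)
  open FiniteField 𝔽 using (isCommutativeRing; inverse; card)

  commutativeRing : CommutativeRing 0ℓ 0ℓ
  commutativeRing = record { isCommutativeRing = isCommutativeRing }

  module R = CommutativeRing commutativeRing
  open R public
    using (_+_; _*_; -_; _-_; 0#; 1#; +-identityʳ; -‿inverseʳ; *-assoc; *-comm; *-identityˡ; *-identityʳ; zeroˡ; zeroʳ)
  open import Algebra.Properties.Group R.+-group using (x∙y⁻¹≈ε⇒x≈y)
  open import Algebra.Properties.Ring R.ring using (-0#≈0#)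
  open import Algebra.Properties.Semiring.Exp R.semiring public using (_^_)
  open import Algebra.Properties.CommutativeMonoid.Sum R.*-commutativeMonoid
    using (sum-permute; sum-cong-≗; ∑-distrib-+; sum-replicate) renaming (sum to ∏)

  _≟_ : DecidableEquality F
  _≟_ = via-injection (↔⇒↣ (↔-sym card)) Fin._≟_

  x-y≡0⇒x≡y : ∀ x y → x - y ≡ 0# → x ≡ y
  x-y≡0⇒x≡y = x∙y⁻¹≈ε⇒x≈y

  x*[y*w]≡w : ∀ {x y} → x * y ≡ 1# → ∀ w → x * (y * w) ≡ w
  x*[y*w]≡w {x} {y} xy≡1 w = begin
    x * (y * w)  ≡⟨ *-assoc x y w ⟨
    (x * y) * w  ≡⟨ cong (_* w) xy≡1 ⟩
    1# * w       ≡⟨ *-identityˡ w ⟩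
    w            ∎
    where open ≡-Reasoning

  y*[x*w]≡w : ∀ {x y} → x * y ≡ 1# → ∀ w → y * (x * w) ≡ w
  y*[x*w]≡w {x} {y} xy≡1 = x*[y*w]≡w (trans (*-comm y x) xy≡1)

  *-cancelˡ : ∀ {x} → x ≢ 0# → ∀ y z → x * y ≡ x * z → y ≡ z
  *-cancelˡ {x} x≢0 y z xy≡xz with inverse x x≢0
  ... | x⁻¹ , xx⁻¹≡1 = begin
    y              ≡⟨ y*[x*w]≡w xx⁻¹≡1 y ⟨
    x⁻¹ * (x * y)  ≡⟨ cong (x⁻¹ *_) xy≡xz ⟩
    x⁻¹ * (x * z)  ≡⟨ y*[x*w]≡w xx⁻¹≡1 z ⟩
    z              ∎
    where open ≡-Reasoning

  x*y≡0⇒x≡0⊎y≡0 : ∀ x y → x * y ≡ 0# → x ≡ 0# ⊎ y ≡ 0#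
  x*y≡0⇒x≡0⊎y≡0 x y xy≡0 with x ≟ 0#
  ... | yes x≡0 = inj₁ x≡0
  ... | no  x≢0 = inj₂ (*-cancelˡ x≢0 y 0# (trans xy≡0 (sym (zeroʳ x))))

  x*y≡y⇒x≡1 : ∀ {x y} → y ≢ 0# → x * y ≡ y → x ≡ 1#
  x*y≡y⇒x≡1 {x} {y} y≢0 xy≡y =
    *-cancelˡ y≢0 x 1# (trans (*-comm y x) (trans xy≡y (sym (*-identityʳ y))))

  ∏-≢0 : ∀ {n} (h : Fin n → F) → (∀ i → h i ≢ 0#) → ∏ h ≢ 0#
  ∏-≢0 {zero}  h h≢0 ∏≡0 = 0≢1 (sym ∏≡0)
  ∏-≢0 {suc n} h h≢0 ∏≡0 with x*y≡0⇒x≡0⊎y≡0 _ _ ∏≡0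
  ... | inj₁ h₀≡0 = h≢0 Fin.zero h₀≡0
  ... | inj₂ ∏≡0′ = ∏-≢0 (h ∘ Fin.suc) (h≢0 ∘ Fin.suc) ∏≡0′

  ∏-scale : ∀ {n} y (h : Fin n → F) → ∏ (λ i → y * h i) ≡ y ^ n * ∏ h
  ∏-scale {n} y h = trans (∑-distrib-+ (λ _ → y) h) (cong (_* ∏ h) (sum-replicate n))

  *-↔ : ∀ {y} → y ≢ 0# → F ↔ F
  *-↔ {y} y≢0 with inverse y y≢0
  ... | y⁻¹ , yy⁻¹≡1 = mk↔ₛ′ (y *_) (y⁻¹ *_) (x*[y*w]≡w yy⁻¹≡1) (y*[x*w]≡w yy⁻¹≡1)

  module _ {n} (enum : Fin (suc n) ↔ F) where
    open Inverse enum using (to; from; strictlyInverseˡ; strictlyInverseʳ)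

    nonzero : Fin n → F
    nonzero i = to (punchIn (from 0#) i)

    nonzero-≢0 : ∀ i → nonzero i ≢ 0#
    nonzero-≢0 i eq = punchInᵢ≢i (from 0#) i (trans (sym (strictlyInverseʳ _)) (cong from eq))

    -- Multiplication by y, read on indices, fixes the index of 0; removing that index leaves
    -- a permutation of the nonzero elements.
    nonzero-scale : ∀ {y} → y ≢ 0# → ∃[ σ ] ∀ i → nonzero (σ ⟨$⟩ʳ i) ≡ y * nonzero i
    nonzero-scale {y} y≢0 = σ , λ i → begin
      to (punchIn (from 0#) (σ ⟨$⟩ʳ i))        ≡⟨ cong (λ z → to (punchIn z (σ ⟨$⟩ʳ i))) π-fixes-0 ⟨
      to (punchIn (π ⟨$⟩ʳ from 0#) (σ ⟨$⟩ʳ i))  ≡⟨ cong to (punchIn-permute π (from 0#) i) ⟨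
      to (π ⟨$⟩ʳ punchIn (from 0#) i)          ≡⟨ strictlyInverseˡ _ ⟩
      y * nonzero i                            ∎
      where
      open ≡-Reasoning
      π : Permutation (suc n) (suc n)
      π = ↔-trans enum (↔-trans (*-↔ y≢0) (↔-sym enum))
      σ : Permutation n n
      σ = remove (from 0#) π
      π-fixes-0 : π ⟨$⟩ʳ from 0# ≡ from 0#
      π-fixes-0 = cong from (trans (cong (y *_) (strictlyInverseˡ 0#)) (zeroʳ y))

    x^n≡1 : ∀ {y} → y ≢ 0# → y ^ n ≡ 1#
    x^n≡1 {y} y≢0 with nonzero-scale y≢0
    ... | σ , σ-scales = x*y≡y⇒x≡1 (∏-≢0 nonzero nonzero-≢0) (begin
      y ^ n * ∏ nonzero              ≡⟨ ∏-scale y nonzero ⟨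
      ∏ (λ i → y * nonzero i)        ≡⟨ sum-cong-≗ σ-scales ⟨
      ∏ (λ i → nonzero (σ ⟨$⟩ʳ i))   ≡⟨ sum-permute nonzero σ ⟨
      ∏ nonzero                      ∎)
      where open ≡-Reasoning

  x^[q∸1]≡1 : ∀ {y} → y ≢ 0# → y ^ (q ∸ 1) ≡ 1#
  x^[q∸1]≡1 = go card
    where
    go : ∀ {k} → Fin k ↔ F → ∀ {y} → y ≢ 0# → y ^ (k ∸ 1) ≡ 1#
    go {zero}  enum = case Inverse.from enum 0# of λ ()
    go {suc k} enum = x^n≡1 enum

  0^[q∸1]≡0 : 0# ^ (q ∸ 1) ≡ 0#
  0^[q∸1]≡0 = go card
    where
    go : ∀ {k} → Fin k ↔ F → 0# ^ (k ∸ 1) ≡ 0#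
    go {zero}        enum = case Inverse.from enum 0# of λ ()
    go {suc zero}    enum = ⊥-elim (0≢1 (Injection.injective (↔⇒↣ (↔-sym enum)) (singleton _ _)))
      where
      singleton : (i j : Fin 1) → i ≡ j
      singleton Fin.zero Fin.zero = refl
    go {suc (suc k)} enum = zeroˡ (0# ^ k)

  δ : F → F → F
  δ x y = 1# - (x - y) ^ (q ∸ 1)

  δ-refl : ∀ x → δ x x ≡ 1#
  δ-refl x = begin
    1# - (x - x) ^ (q ∸ 1)  ≡⟨ cong (λ z → 1# - z ^ (q ∸ 1)) (-‿inverseʳ x) ⟩
    1# - 0# ^ (q ∸ 1)       ≡⟨ cong (λ z → 1# - z) 0^[q∸1]≡0 ⟩
    1# - 0#                 ≡⟨ cong (1# +_) -0#≈0# ⟩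
    1# + 0#                 ≡⟨ +-identityʳ 1# ⟩
    1#                      ∎
    where open ≡-Reasoning

  δ-≢ : ∀ {x y} → x ≢ y → δ x y ≡ 0#
  δ-≢ {x} {y} x≢y = begin
    1# - (x - y) ^ (q ∸ 1)  ≡⟨ cong (λ z → 1# - z) (x^[q∸1]≡1 (x≢y ∘ x-y≡0⇒x≡y x y)) ⟩
    1# - 1#                 ≡⟨ -‿inverseʳ 1# ⟩
    0#                      ∎
    where open ≡-Reasoning

module PolynomialEvaluation (𝔽 : FiniteField) where
  open FiniteFieldProperties 𝔽
  module P = Polynomials 𝔽
  open P using (Poly; con; _^ₚ_; prodₚ; _≈ₚ_; eval; ⟨_⟩; 𝕍)

  eval-resp-≈ₚ : ∀ {V} (x : V → F) {a b : Poly V} → a ≈ₚ b → eval x a ≡ eval x b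
  eval-resp-≈ₚ x P.refl               = refl
  eval-resp-≈ₚ x (P.sym a≈b)          = sym (eval-resp-≈ₚ x a≈b)
  eval-resp-≈ₚ x (P.trans a≈b b≈c)    = trans (eval-resp-≈ₚ x a≈b) (eval-resp-≈ₚ x b≈c)
  eval-resp-≈ₚ x (P.+-cong a≈b c≈d)   = cong₂ _+_ (eval-resp-≈ₚ x a≈b) (eval-resp-≈ₚ x c≈d)
  eval-resp-≈ₚ x (P.*-cong a≈b c≈d)   = cong₂ _*_ (eval-resp-≈ₚ x a≈b) (eval-resp-≈ₚ x c≈d)
  eval-resp-≈ₚ x (P.-‿cong a≈b)       = cong -_ (eval-resp-≈ₚ x a≈b)
  eval-resp-≈ₚ x (P.+-assoc _ _ _)    = R.+-assoc _ _ _
  eval-resp-≈ₚ x (P.+-comm _ _)       = R.+-comm _ _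
  eval-resp-≈ₚ x (P.+-idˡ _)          = R.+-identityˡ _
  eval-resp-≈ₚ x (P.-‿invˡ _)         = R.-‿inverseˡ _
  eval-resp-≈ₚ x (P.*-assoc _ _ _)    = R.*-assoc _ _ _
  eval-resp-≈ₚ x (P.*-comm _ _)       = R.*-comm _ _
  eval-resp-≈ₚ x (P.*-idˡ _)          = R.*-identityˡ _
  eval-resp-≈ₚ x (P.distribˡ _ _ _)   = R.distribˡ _ _ _
  eval-resp-≈ₚ x (P.con-+ _ _)        = refl
  eval-resp-≈ₚ x (P.con-* _ _)        = refl
  eval-resp-≈ₚ x (P.con-- _)          = refl

  eval-^ₚ : ∀ {V} (x : V → F) a n → eval x (a ^ₚ n) ≡ eval x a ^ n
  eval-^ₚ x a zero    = refl
  eval-^ₚ x a (suc n) = cong (eval x a *_) (eval-^ₚ x a n)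

  eval-prodₚ≡0⇔ : ∀ {V} (x : V → F) ps → eval x (prodₚ ps) ≡ 0# ⇔ Any (λ p → eval x p ≡ 0#) ps
  eval-prodₚ≡0⇔ x ps = mk⇔ (to ps) from
    where
    to : ∀ ps → eval x (prodₚ ps) ≡ 0# → Any (λ p → eval x p ≡ 0#) ps
    to []       1≡0 = ⊥-elim (0≢1 (sym 1≡0))
    to (p ∷ ps) ∏≡0 with x*y≡0⇒x≡0⊎y≡0 _ _ ∏≡0
    ... | inj₁ p≡0  = here p≡0
    ... | inj₂ ∏≡0′ = there (to ps ∏≡0′)
    from : ∀ {ps} → Any (λ p → eval x p ≡ 0#) ps → eval x (prodₚ ps) ≡ 0#
    from (here p≡0)  = trans (cong (_* _) p≡0) (zeroˡ _)
    from (there ∏≡0) = trans (cong (_ *_) (from ∏≡0)) (zeroʳ _)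

  eval-prodₚ≡1 : ∀ {V} (x : V → F) {ps} → All (λ p → eval x p ≡ 1#) ps → eval x (prodₚ ps) ≡ 1#
  eval-prodₚ≡1 x []           = refl
  eval-prodₚ≡1 x (p≡1 ∷ ps≡1) = trans (cong₂ _*_ p≡1 (eval-prodₚ≡1 x ps≡1)) (*-identityˡ 1#)

  𝕍⟨p⟩⇔p≡0 : ∀ {V} (x : V → F) p → 𝕍 ⟨ p ⟩ x ⇔ eval x p ≡ 0#
  𝕍⟨p⟩⇔p≡0 x p = mk⇔
    (λ x∈𝕍 → x∈𝕍 p (con 1# , P.sym (P.*-idˡ p)))
    (λ p≡0 g (h , g≈hp) → trans (eval-resp-≈ₚ x g≈hp) (trans (cong (eval x h *_) p≡0) (zeroʳ _)))

AgreesAlong : {G X : Graph} {C : Set} → (Edge G → C) → Hom X C → EdgeMap G X → Set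
AgreesAlong x φ π = ∀ e d → (e , d) ∈ π → x e ≡ φ d

ContainsCopy : (G X : Graph) {C : Set} → (Edge G → C) → Hom X C → Set
ContainsCopy G X x φ = ∃[ π ] π ∈ IsoSet G X × AgreesAlong x φ π

module _ {G X : Graph} {A B : Set} {f : A → B} (f-injective : Injective _≡_ _≡_ f)
         {ρ : Edge G → A} {x : Edge G → B} (x≗f∘ρ : ∀ e → x e ≡ f (ρ e)) (φ : Hom X A) where

  agreesAlong-transport : ∀ π → AgreesAlong x (f ∘ φ) π ⇔ AgreesAlong ρ φ π
  agreesAlong-transport π = mk⇔
    (λ agrees e d ed∈π → f-injective (trans (sym (x≗f∘ρ e)) (agrees e d ed∈π)))
    (λ agrees e d ed∈π → trans (x≗f∘ρ e) (cong f (agrees e d ed∈π)))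

  containsCopy-transport : ContainsCopy G X x (f ∘ φ) ⇔ ContainsCopy G X ρ φ
  containsCopy-transport = mk⇔
    (map₂ (map₂ (Equivalence.to (agreesAlong-transport _))))
    (map₂ (map₂ (Equivalence.from (agreesAlong-transport _))))

module CopyPolynomial (𝔽 : FiniteField) where
  open FiniteFieldProperties 𝔽
  open PolynomialEvaluation 𝔽
  open Polynomials 𝔽 using (Poly; con; var; _-ₚ_; _^ₚ_; prodₚ; eval; pGXφ; pFamily)

  module _ {G X : Graph} (φ : Hom X F) where
    agreement : Edge G × Edge X → Poly (Edge G)
    agreement (e , d) = con 1# -ₚ ((var e -ₚ con (φ d)) ^ₚ (q ∸ 1))

    copyFactor : EdgeMap G X → Poly (Edge G)
    copyFactor π = con 1# -ₚ prodₚ (map agreement π)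

    module _ (x : Edge G → F) where
      eval-agreement : ∀ e d → eval x (agreement (e , d)) ≡ δ (x e) (φ d)
      eval-agreement e d = cong (λ z → 1# - z) (eval-^ₚ x _ (q ∸ 1))

      copyFactor≡0⇔agreesAlong : ∀ π → eval x (copyFactor π) ≡ 0# ⇔ AgreesAlong x φ π
      copyFactor≡0⇔agreesAlong π = mk⇔ to from
        where
        ∏agreement : F
        ∏agreement = eval x (prodₚ (map agreement π))
        to : eval x (copyFactor π) ≡ 0# → AgreesAlong x φ π
        to 1-∏≡0 e d ed∈π with x e ≟ φ d
        ... | yes xₑ≡φd = xₑ≡φd
        ... | no  xₑ≢φd = ⊥-elim (0≢1 (begin
          0#          ≡⟨ Equivalence.from (eval-prodₚ≡0⇔ x _)
                           (Anyₚ.map⁺ (lose ed∈π (trans (eval-agreement e d) (δ-≢ xₑ≢φd)))) ⟨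
          ∏agreement  ≡⟨ x-y≡0⇒x≡y 1# ∏agreement 1-∏≡0 ⟨
          1#          ∎))
          where open ≡-Reasoning
        from : AgreesAlong x φ π → eval x (copyFactor π) ≡ 0#
        from agrees = trans (cong (λ z → 1# - z) (eval-prodₚ≡1 x factors≡1)) (-‿inverseʳ 1#)
          where
          open ≡-Reasoning
          factors≡1 : All (λ p → eval x p ≡ 1#) (map agreement π)
          factors≡1 = Allₚ.map⁺ (All.tabulate λ {(e , d)} ed∈π → begin
            eval x (agreement (e , d))  ≡⟨ eval-agreement e d ⟩
            δ (x e) (φ d)               ≡⟨ cong (δ (x e)) (agrees e d ed∈π) ⟨
            δ (x e) (x e)               ≡⟨ δ-refl (x e) ⟩
            1#                          ∎)

      pGXφ≡0⇔containsCopy : eval x (pGXφ G X φ) ≡ 0# ⇔ ContainsCopy G X x φ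
      pGXφ≡0⇔containsCopy = mk⇔
        (λ p≡0 → let π , π∈ , π≡0 = find (Anyₚ.map⁻ (Equivalence.to (eval-prodₚ≡0⇔ x _) p≡0))
                 in π , π∈ , Equivalence.to (copyFactor≡0⇔agreesAlong π) π≡0)
        (λ (π , π∈ , agrees) → Equivalence.from (eval-prodₚ≡0⇔ x _)
           (Anyₚ.map⁺ (lose π∈ (Equivalence.from (copyFactor≡0⇔agreesAlong π) agrees))))

  pFamily≡0⇔containsCopy : ∀ {G m} {X : Fin m → Graph} (x : Edge G → F) (φ : (j : Fin m) → Hom (X j) F) →
    eval x (pFamily G m X φ) ≡ 0# ⇔ (∃[ j ] ContainsCopy G (X j) x (φ j))
  pFamily≡0⇔containsCopy x φ = mk⇔
    (λ p≡0 → map₂ (Equivalence.to (pGXφ≡0⇔containsCopy (φ _) x))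
                (Anyₚ.tabulate⁻ (Equivalence.to (eval-prodₚ≡0⇔ x _) p≡0)))
    (λ (j , copy) → Equivalence.from (eval-prodₚ≡0⇔ x _)
       (Anyₚ.tabulate⁺ j (Equivalence.from (pGXφ≡0⇔containsCopy (φ j) x) copy)))

IsLeast-cong : ∀ 𝕀 {P Q : WellOrderedIndex.Idx 𝕀 → Set} → (∀ n → P n ⇔ Q n) →
               ∀ n → IsLeast 𝕀 P n ⇔ IsLeast 𝕀 Q n
IsLeast-cong 𝕀 P⇔Q n = mk⇔
  (λ (Pn , least) → Equivalence.to (P⇔Q n) Pn , λ m Qm → least m (Equivalence.from (P⇔Q m) Qm))
  (λ (Qn , least) → Equivalence.from (P⇔Q n) Qn , λ m Pm → least m (Equivalence.to (P⇔Q m) Pm))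

module RamseyConditionAlgebraically
         (𝕀 : WellOrderedIndex) (B : RamseyBase 𝕀) (Σ' : RamseySymbol 𝕀 (RamseyBase.A B))
         (𝔽 : WellOrderedIndex.Idx 𝕀 → FiniteField)
         (f : (i : WellOrderedIndex.Idx 𝕀) → RamseyBase.A B i → FiniteField.F (𝔽 i))
         (f-injective : ∀ i → Injective _≡_ _≡_ (f i)) where
  open WellOrderedIndex 𝕀
  open RamseyBase B
  open RamseySymbol Σ'
  open Transported 𝕀 B Σ' 𝔽 f
  open Polynomials using (𝕍; ⟨_⟩)

  containsCopy⇔𝕍⟨pₜ⟩ : ∀ t {ρ x} → (∀ e → x e ≡ f t (ρ e)) →
    (∃[ j ] ContainsCopy (G t) (X t j) ρ (ψ t j)) ⇔ 𝕍 (𝔽 t) (⟨_⟩ (𝔽 t) (pₜ t)) x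
  containsCopy⇔𝕍⟨pₜ⟩ t {x = x} x≗f∘ρ = ⇔-trans
    (mk⇔ (map₂ (Equivalence.from (containsCopy-transport (f-injective t) x≗f∘ρ (ψ t _))))
         (map₂ (Equivalence.to   (containsCopy-transport (f-injective t) x≗f∘ρ (ψ t _)))))
    (⇔-trans (⇔-sym (CopyPolynomial.pFamily≡0⇔containsCopy (𝔽 t) x (C′ t)))
             (⇔-sym (PolynomialEvaluation.𝕍⟨p⟩⇔p≡0 (𝔽 t) x (pₜ t))))

  ramsey⇔vanishing : ∀ n → RamseyCondition 𝕀 B Σ' n ⇔ VanishingCondition n
  ramsey⇔vanishing n = mk⇔
    (λ ramsey t n≤t x (ρ , ρ∈S , x≗f∘ρ) →
       Equivalence.to (containsCopy⇔𝕍⟨pₜ⟩ t x≗f∘ρ) (ramsey t n≤t ρ ρ∈S))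
    (λ vanishing t n≤t ρ ρ∈S →
       Equivalence.from (containsCopy⇔𝕍⟨pₜ⟩ t λ _ → refl) (vanishing t n≤t _ (ρ , ρ∈S , λ _ → refl)))

  vanishing⇔ideal : ∀ n → VanishingCondition n ⇔ IdealCondition n
  vanishing⇔ideal n = mk⇔
    (λ vanishing t n≤t g g∈⟨p⟩ x x∈S′ → vanishing t n≤t x x∈S′ g g∈⟨p⟩)
    (λ ideal t n≤t x x∈S′ g g∈⟨p⟩ → ideal t n≤t g g∈⟨p⟩ x x∈S′)

  ramsey⇔ideal : ∀ n → RamseyCondition 𝕀 B Σ' n ⇔ IdealCondition n
  ramsey⇔ideal n = ⇔-trans (ramsey⇔vanishing n) (vanishing⇔ideal n)

theorem6 : (𝕀 : WellOrderedIndex) (B : RamseyBase 𝕀) (Σ' : RamseySymbol 𝕀 (RamseyBase.A B)) →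
    LocallyFinite 𝕀 B →
    (𝔽 : WellOrderedIndex.Idx 𝕀 → FiniteField) →
    (∀ i → PrimePower (FiniteField.q (𝔽 i))) →
    (f : (i : WellOrderedIndex.Idx 𝕀) → RamseyBase.A B i → FiniteField.F (𝔽 i)) →
    (∀ i → Injective _≡_ _≡_ (f i)) →
    (n : WellOrderedIndex.Idx 𝕀) →
    (RamseyNumberIs 𝕀 B Σ' n ⇔ IsLeast 𝕀 (Transported.VanishingCondition 𝕀 B Σ' 𝔽 f) n)
    × (RamseyNumberIs 𝕀 B Σ' n ⇔ IsLeast 𝕀 (Transported.IdealCondition 𝕀 B Σ' 𝔽 f) n)
theorem6 𝕀 B Σ' _ 𝔽 _ f f-injective n =
  IsLeast-cong 𝕀 ramsey⇔vanishing n , IsLeast-cong 𝕀 ramsey⇔ideal n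
  where open RamseyConditionAlgebraically 𝕀 B Σ' 𝔽 f f-injective
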